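{- Let $m\ge1$, $n\ge1$ and $0\le k\le n-1$ be integers. Then \[ T^{(m)}_{n,k}=\sum_{\substack{t_1+t_2+\cdots+t_{k+1}=n-k-1\\ t_1,\dots,t_{k+1}\ge0}}1^{t_1}2^{t_2}\cdots(k+1)^{t_{k+1}}\prod_{j=1}^{k}\bigl(m(t_1+\cdots+t_j)+j(m-1)+1\bigr), \] that is, the product is $(mt_1+m)(m(t_1+t_2)+2(m-1)+1)\cdots(m(t_1+\cdots+t_k)+k(m-1)+1)$ (empty product $=1$ when $k=0$). In particular, for $m=1$, \[ T^{(1)}_{n,k}=\sum_{\substack{t_1+\cdots+t_{k+1}=n-k-1\\ t_1,\dots,t_{k+1}\ge0}}1^{t_1}2^{t_2}\cdots(k+1)^{t_{k+1}}(t_1+1)(t_1+t_2+1)\cdots(t_1+\cdots+t_k+1). \]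
   Context: Let $m\ge1$, $n\ge1$ be integers. An $m$-Stirling permutation of order $n$ is a word $a_1a_2\cdots a_{mn}$ that is a permutation of the multiset in which each of $1,2,\dots,n$ occurs exactly $m$ times, such that whenever $u<v<w$ and $a_u=a_w$, one has $a_u\ge a_v$. A descent of such a word is an index $j\in\{1,\dots,mn-1\}$ with $a_j>a_{j+1}$. The $m$th-order Eulerian number $T^{(m)}_{n,k}$ is the number of $m$-Stirling permutations of order $n$ with exactly $k$ descents; by convention $T^{(m)}_{n,k}=0$ for $k<0$ or $k\ge n$, and $T^{(m)}_{1,0}=1$. -}

module Defs where

open import Data.Nat using (ℕ; zero; suc; _+_; _*_; _∸_; _^_; _≤_; _<_; _≤?_; _<?_)
open import Data.Nat.Properties using (_≟_)
open import Data.Fin using (Fin; toℕ) renaming (_≟_ to _≟ᶠ_)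
open import Data.Fin.Properties using (all?)
open import Data.Vec using (Vec; []; _∷_; lookup; toList; count)
open import Data.List using (List; [_]; map; concatMap; upTo; filter; length; take; allFin)
open import Data.Nat.ListAction using (sum; product)
open import Data.Bool using (if_then_else_)
open import Relation.Binary.PropositionalEquality using (_≡_)
open import Relation.Nullary.Decidable using (Dec; yes; no; isYes; _×-dec_; _→-dec_)
open import Data.Product using (_×_)

-- A word a₁…a_L over the alphabet {1,…,n} is represented as a
-- vector  Vec (Fin n) L ; the letter i ∈ {1,…,n} is encoded by the
-- element of Fin n with  toℕ = i - 1.  This shift preserves equality
-- and order, so descents and the Stirling condition are unchanged.

allWords : (n L : ℕ) → List (Vec (Fin n) L)
allWords n zero    = [ [] ]
allWords n (suc L) = concatMap (λ x → map (x ∷_) (allWords n L)) (allFin n)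

IsMultisetPerm : (m : ℕ) {n L : ℕ} → Vec (Fin n) L → Set
IsMultisetPerm m {n} a = (i : Fin n) → count (_≟ᶠ i) a ≡ m

IsStirlingCond : {n L : ℕ} → Vec (Fin n) L → Set
IsStirlingCond {n} {L} a =
  (u v w : Fin L) → toℕ u < toℕ v → toℕ v < toℕ w →
  lookup a u ≡ lookup a w → toℕ (lookup a v) ≤ toℕ (lookup a u)

IsStirlingPerm : (m n : ℕ) → Vec (Fin n) (m * n) → Set
IsStirlingPerm m n a = IsMultisetPerm m a × IsStirlingCond a

descents : {n L : ℕ} → Vec (Fin n) L → ℕ
descents []       = 0
descents (x ∷ xs) = go x xs
  where
  go : {n L : ℕ} → Fin n → Vec (Fin n) L → ℕ
  go p []       = 0
  go p (y ∷ ys) = (if isYes (toℕ y <? toℕ p) then 1 else 0) + go y ys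

isMultisetPerm? : (m : ℕ) {n L : ℕ} (a : Vec (Fin n) L) → Dec (IsMultisetPerm m a)
isMultisetPerm? m a = all? (λ i → count (_≟ᶠ i) a ≟ m)

isStirlingCond? : {n L : ℕ} (a : Vec (Fin n) L) → Dec (IsStirlingCond a)
isStirlingCond? a =
  all? λ u → all? λ v → all? λ w →
    (toℕ u <? toℕ v) →-dec ((toℕ v <? toℕ w) →-dec
      ((lookup a u ≟ᶠ lookup a w) →-dec (toℕ (lookup a v) ≤? toℕ (lookup a u))))

T : (m n k : ℕ) → ℕ
T m n k = length (filter
  (λ a → (isMultisetPerm? m a ×-dec isStirlingCond? a) ×-dec (descents a ≟ k))
  (allWords n (m * n)))

boundedVecs : (r N : ℕ) → List (Vec ℕ r)
boundedVecs zero    N = [ [] ]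
boundedVecs (suc r) N = concatMap (λ x → map (x ∷_) (boundedVecs r N)) (upTo (suc N))

compositions : (r N : ℕ) → List (Vec ℕ r)
compositions r N = filter (λ t → sum (toList t) ≟ N) (boundedVecs r N)

powerPart : {r : ℕ} → Vec ℕ r → ℕ
powerPart {r} t = product (map (λ i → suc (toℕ i) ^ lookup t i) (allFin r))

prodPart : (m k : ℕ) → Vec ℕ (suc k) → ℕ
prodPart m k t = product (map
  (λ (j : Fin k) → m * sum (take (suc (toℕ j)) (toList t)) + suc (toℕ j) * (m ∸ 1) + 1)
  (allFin k))

RHS : (m n k : ℕ) → ℕ
RHS m n k = sum (map (λ t → powerPart t * prodPart m k t) (compositions (suc k) (n ∸ k ∸ 1)))

{-# OPTIONS --safe #-}
module Submission where

-- The least letter of an m-Stirling permutation of order n + 1 fills one block of m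
-- consecutive positions, so removing that block (and shifting the other letters down) is a
-- bijection onto pairs of an m-Stirling permutation of order n and one of its mn + 1 gaps.
-- The block adds no descent in the first gap or inside a descent and exactly one descent in
-- each of the other mn − d gaps, d the number of descents; hence
--   T(n+1, 0) = T(n, 0) = 1   and   T(n+1, k+1) = (k+2) T(n, k+1) + (mn − k) T(n, k).
-- Unrolled in n, the second recurrence reads
--   T(N+d+2, d+1) = Σ_{s ≤ N} (d+2)^s (m(N−s) + (d+1)(m−1) + 1) T(N−s+d+1, d),
-- and splitting off the last part t_{d+1} = s of a composition shows that the right-hand
-- side satisfies the same relation, so the formula follows by induction on d.

open import Defs
open import Data.Bool using (if_then_else_)
open import Data.Empty using (⊥-elim)
open import Data.Fin using (Fin; toℕ; fromℕ; inject₁) renaming (zero to fzero; suc to fsuc; _≟_ to _≟ᶠ_)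
open import Data.Fin.Properties using (toℕ-inject₁; toℕ-fromℕ; toℕ<n) renaming (suc-injective to fsuc-injective)
open import Data.List using (List; []; _∷_; _++_; map; filter; length; concatMap; cartesianProductWith; tabulate; allFin; upTo; applyUpTo; take; replicate)
open import Data.List.Membership.Propositional using (_∈_)
open import Data.List.Membership.Propositional.Properties using (∈-map⁺; ∈-map⁻; ∈-filter⁺; ∈-filter⁻; ∈-cartesianProductWith⁺; ∈-cartesianProductWith⁻; ∈-allFin)
open import Data.List.Membership.Propositional.Properties.WithK using (unique∧set⇒bag)
open import Data.List.Properties using (map-++; map-∘; map-cong; map-tabulate; tabulate-cong; take-all; length-++; length-map; length-replicate; ++-cancelˡ; map-injective; ∷-injective)
open import Data.List.Relation.Binary.BagAndSetEquality using (∼bag⇒↭)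
open import Data.List.Relation.Binary.Permutation.Propositional.Properties using (↭-length)
open import Data.List.Relation.Unary.All using ([])
open import Data.List.Relation.Unary.AllPairs using ([]; _∷_)
open import Data.List.Relation.Unary.Any using (here; there)
open import Data.List.Relation.Unary.Unique.Propositional using (Unique)
open import Data.List.Relation.Unary.Unique.Propositional.Properties using (map⁺; filter⁺; cartesianProductWith⁺; allFin⁺)
open import Data.Nat using (ℕ; zero; suc; _+_; _*_; _∸_; _^_; _≤_; _<_; z≤n; s≤s; _≤?_; _<?_)
open import Data.Nat.ListAction using (sum; product)
open import Data.Nat.ListAction.Properties using (sum-++)
open import Data.Nat.Properties
open import Algebra.Properties.CommutativeSemigroup +-commutativeSemigroup using (interchange; x∙yz≈y∙xz)
open import Data.Nat.Tactic.RingSolver using (solve-∀)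
open import Data.Product using (_×_; _,_; ∃)
open import Data.Unit using (⊤; tt)
open import Data.Vec using (Vec; []; _∷_; toList; fromList; _∷ʳ_; lookup; count; cast)
open import Data.Vec.Membership.Propositional.Properties using (∈-lookup; ∈-toList⁺; ∈-toList⁻)
open import Data.Vec.Properties using (length-toList; toList∘fromList; toList-injective; toList-cast) renaming (∷-injective to ∷-injectiveᵛ)
open import Data.Vec.Relation.Binary.Equality.Cast using (cast-is-id)
open import Data.Vec.Relation.Unary.Any using (index)
open import Data.Vec.Relation.Unary.Any.Properties using (lookup-index)
open import Function using (_∘_)
open import Function.Bundles using (_⇔_; mk⇔; Equivalence)
open import Relation.Binary.PropositionalEquality
open import Relation.Nullary using (¬_)
open import Relation.Nullary.Decidable using (Dec; yes; no; isYes; _×-dec_)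
open import Relation.Unary using (Pred; Decidable)

open ≡-Reasoning

-- Indicators and finite sums

-- Defined through isYes, as in the descent count of Defs, so that descentFlag below unfolds to it.
indicator : {P : Set} → Dec P → ℕ
indicator P? = if isYes P? then 1 else 0

module _ {P Q : Set} where

  indicator-cong : (P → Q) → (Q → P) → (P? : Dec P) (Q? : Dec Q) → indicator P? ≡ indicator Q?
  indicator-cong _   _   (yes _) (yes _) = refl
  indicator-cong p→q _   (yes p) (no ¬q) = ⊥-elim (¬q (p→q p))
  indicator-cong _   q→p (no ¬p) (yes q) = ⊥-elim (¬p (q→p q))
  indicator-cong _   _   (no _)  (no _)  = refl

  indicator-×-dec : (P? : Dec P) (Q? : Dec Q) → indicator (P? ×-dec Q?) ≡ indicator P? * indicator Q?
  indicator-×-dec (yes _) (yes _) = refl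
  indicator-×-dec (yes _) (no _)  = refl
  indicator-×-dec (no _)  _       = refl

indicator-yes : {P : Set} (P? : Dec P) → P → indicator P? ≡ 1
indicator-yes (yes _) _ = refl
indicator-yes (no ¬p) p = ⊥-elim (¬p p)

indicator-no : {P : Set} (P? : Dec P) → ¬ P → indicator P? ≡ 0
indicator-no (yes p) ¬p = ⊥-elim (¬p p)
indicator-no (no _)  _  = refl

indicator≤1 : {P : Set} (P? : Dec P) → indicator P? ≤ 1
indicator≤1 (yes _) = ≤-refl
indicator≤1 (no _)  = z≤n

*-indicator-≟ : ∀ (f : ℕ → ℕ) c d k → f d * (c * indicator (d ≟ k)) ≡ f k * (c * indicator (d ≟ k))
*-indicator-≟ f c d k with d ≟ k
... | yes refl = refl
... | no _ rewrite *-zeroʳ c = trans (*-zeroʳ (f d)) (sym (*-zeroʳ (f k)))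

module _ {A : Set} where

  length-filter : {P : Pred A _} (P? : Decidable P) (xs : List A) →
                  length (filter P? xs) ≡ sum (map (indicator ∘ P?) xs)
  length-filter P? []       = refl
  length-filter P? (x ∷ xs) with P? x
  ... | yes _ = cong suc (length-filter P? xs)
  ... | no _  = length-filter P? xs

  sum-map-filter : {P : Pred A _} (P? : Decidable P) (f : A → ℕ) (xs : List A) →
                   sum (map f (filter P? xs)) ≡ sum (map (λ x → indicator (P? x) * f x) xs)
  sum-map-filter P? f []       = refl
  sum-map-filter P? f (x ∷ xs) with P? x
  ... | yes _ = cong₂ _+_ (sym (+-identityʳ (f x))) (sum-map-filter P? f xs)
  ... | no _  = sum-map-filter P? f xs

  sum-map-+ : (f g : A → ℕ) (xs : List A) → sum (map (λ x → f x + g x) xs) ≡ sum (map f xs) + sum (map g xs)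
  sum-map-+ f g []       = refl
  sum-map-+ f g (x ∷ xs) = trans (cong (f x + g x +_) (sum-map-+ f g xs)) (interchange (f x) (g x) _ _)

  sum-map-*ˡ : (c : ℕ) (f : A → ℕ) (xs : List A) → sum (map (λ x → c * f x) xs) ≡ c * sum (map f xs)
  sum-map-*ˡ c f []       = sym (*-zeroʳ c)
  sum-map-*ˡ c f (x ∷ xs) = trans (cong (c * f x +_) (sum-map-*ˡ c f xs)) (sym (*-distribˡ-+ c (f x) _))

  unique∧set⇒length≡ : {xs ys : List A} → Unique xs → Unique ys →
                       (∀ {z} → z ∈ xs → z ∈ ys) → (∀ {z} → z ∈ ys → z ∈ xs) → length xs ≡ length ys
  unique∧set⇒length≡ xs! ys! xs⊆ys ys⊆xs = ↭-length (∼bag⇒↭ (unique∧set⇒bag xs! ys! (mk⇔ xs⊆ys ys⊆xs)))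

module _ {A B C : Set} (f : A → B → C) where

  concatMap≡cartesianProductWith : (xs : List A) (ys : List B) →
                                   concatMap (λ x → map (f x) ys) xs ≡ cartesianProductWith f xs ys
  concatMap≡cartesianProductWith []       ys = refl
  concatMap≡cartesianProductWith (x ∷ xs) ys = cong (map (f x) ys ++_) (concatMap≡cartesianProductWith xs ys)

  sum-map-cartesianProductWith : (h : C → ℕ) (xs : List A) (ys : List B) →
    sum (map h (cartesianProductWith f xs ys)) ≡ sum (map (λ x → sum (map (λ y → h (f x y)) ys)) xs)
  sum-map-cartesianProductWith h []       ys = refl
  sum-map-cartesianProductWith h (x ∷ xs) ys = begin
    sum (map h (map (f x) ys ++ cartesianProductWith f xs ys))
      ≡⟨ cong sum (map-++ h (map (f x) ys) _) ⟩
    sum (map h (map (f x) ys) ++ map h (cartesianProductWith f xs ys))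
      ≡⟨ sum-++ (map h (map (f x) ys)) _ ⟩
    sum (map h (map (f x) ys)) + sum (map h (cartesianProductWith f xs ys))
      ≡⟨ cong₂ _+_ (cong sum (sym (map-∘ ys))) (sum-map-cartesianProductWith h xs ys) ⟩
    sum (map (λ y → h (f x y)) ys) + sum (map (λ x → sum (map (λ y → h (f x y)) ys)) xs) ∎

∑< : ℕ → (ℕ → ℕ) → ℕ
∑< zero    f = 0
∑< (suc n) f = f 0 + ∑< n (λ x → f (suc x))

syntax ∑< n (λ x → e) = ∑[ x < n ] e

∑-cong< : ∀ n {f g : ℕ → ℕ} → (∀ x → x < n → f x ≡ g x) → ∑< n f ≡ ∑< n g
∑-cong< zero    f≡g = refl
∑-cong< (suc n) f≡g = cong₂ _+_ (f≡g 0 (s≤s z≤n)) (∑-cong< n (λ x x<n → f≡g (suc x) (s≤s x<n)))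

∑-cong : ∀ n {f g : ℕ → ℕ} → (∀ x → f x ≡ g x) → ∑< n f ≡ ∑< n g
∑-cong n f≡g = ∑-cong< n (λ x _ → f≡g x)

∑-zero : ∀ n → ∑[ x < n ] 0 ≡ 0
∑-zero zero    = refl
∑-zero (suc n) = ∑-zero n

∑-+ : ∀ n (f g : ℕ → ℕ) → ∑[ x < n ] (f x + g x) ≡ ∑< n f + ∑< n g
∑-+ zero    f g = refl
∑-+ (suc n) f g = trans (cong (f 0 + g 0 +_) (∑-+ n (λ x → f (suc x)) (λ x → g (suc x)))) (interchange (f 0) (g 0) _ _)

∑-*ˡ : ∀ n c (f : ℕ → ℕ) → ∑[ x < n ] (c * f x) ≡ c * ∑< n f
∑-*ˡ zero    c f = sym (*-zeroʳ c)
∑-*ˡ (suc n) c f = trans (cong (c * f 0 +_) (∑-*ˡ n c (λ x → f (suc x)))) (sym (*-distribˡ-+ c (f 0) _))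

sum-map-applyUpTo : ∀ n (f g : ℕ → ℕ) → sum (map f (applyUpTo g n)) ≡ ∑[ x < n ] f (g x)
sum-map-applyUpTo zero    f g = refl
sum-map-applyUpTo (suc n) f g = cong (f (g 0) +_) (sum-map-applyUpTo n f (λ x → g (suc x)))

∑-vanishing-tail : ∀ n B (f : ℕ → ℕ) → n ≤ B → (∀ x → n ≤ x → f x ≡ 0) → ∑< B f ≡ ∑< n f
∑-vanishing-tail zero    B       f _       f≡0 = trans (∑-cong B (λ x → f≡0 x z≤n)) (∑-zero B)
∑-vanishing-tail (suc n) (suc B) f (s≤s n≤B) f≡0 =
  cong (f 0 +_) (∑-vanishing-tail n B (λ x → f (suc x)) n≤B (λ x n≤x → f≡0 (suc x) (s≤s n≤x)))

∑-comm : ∀ n p (f : ℕ → ℕ → ℕ) → ∑[ x < n ] ∑[ y < p ] f x y ≡ ∑[ y < p ] ∑[ x < n ] f x y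
∑-comm zero    p f = sym (∑-zero p)
∑-comm (suc n) p f = trans (cong (∑< p (f 0) +_) (∑-comm n p (λ x → f (suc x))))
                           (sym (∑-+ p (f 0) (λ y → ∑[ x < n ] f (suc x) y)))

∑-indicator-restrict : ∀ N x (f : ℕ → ℕ) → x ≤ N →
                       ∑[ y < suc N ] (indicator (x + y ≤? N) * f y) ≡ ∑< (suc (N ∸ x)) f
∑-indicator-restrict N x f x≤N = begin
  ∑[ y < suc N ] (indicator (x + y ≤? N) * f y)
    ≡⟨ ∑-vanishing-tail (suc (N ∸ x)) (suc N) _ (s≤s (m∸n≤m N x)) outside ⟩
  ∑[ y < suc (N ∸ x) ] (indicator (x + y ≤? N) * f y)
    ≡⟨ ∑-cong< (suc (N ∸ x)) inside ⟩
  ∑< (suc (N ∸ x)) f ∎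
  where
  outside : ∀ y → suc (N ∸ x) ≤ y → indicator (x + y ≤? N) * f y ≡ 0
  outside y N∸x<y = cong (_* f y) (indicator-no (x + y ≤? N)
    (λ x+y≤N → <⇒≱ N∸x<y (subst (_≤ N ∸ x) (m+n∸m≡n x y) (∸-monoˡ-≤ x x+y≤N))))
  inside : ∀ y → y < suc (N ∸ x) → indicator (x + y ≤? N) * f y ≡ f y
  inside y (s≤s y≤N∸x) = trans (cong (_* f y) (indicator-yes (x + y ≤? N)
    (subst (x + y ≤_) (m+[n∸m]≡n x≤N) (+-monoʳ-≤ x y≤N∸x)))) (+-identityʳ (f y))

∑-triangle-comm : ∀ N (f : ℕ → ℕ → ℕ) →
  ∑[ x < suc N ] ∑[ y < suc (N ∸ x) ] f x y ≡ ∑[ y < suc N ] ∑[ x < suc (N ∸ y) ] f x y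
∑-triangle-comm N f = begin
  ∑[ x < suc N ] ∑[ y < suc (N ∸ x) ] f x y
    ≡⟨ ∑-cong< (suc N) (λ x x≤N → sym (∑-indicator-restrict N x (f x) (≤-pred x≤N))) ⟩
  ∑[ x < suc N ] ∑[ y < suc N ] (indicator (x + y ≤? N) * f x y)
    ≡⟨ ∑-comm (suc N) (suc N) (λ x y → indicator (x + y ≤? N) * f x y) ⟩
  ∑[ y < suc N ] ∑[ x < suc N ] (indicator (x + y ≤? N) * f x y)
    ≡⟨ ∑-cong (suc N) (λ y → ∑-cong (suc N) (λ x → cong (_* f x y) (+-comm-indicator x y))) ⟩
  ∑[ y < suc N ] ∑[ x < suc N ] (indicator (y + x ≤? N) * f x y)
    ≡⟨ ∑-cong< (suc N) (λ y y≤N → ∑-indicator-restrict N y (λ x → f x y) (≤-pred y≤N)) ⟩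
  ∑[ y < suc N ] ∑[ x < suc (N ∸ y) ] f x y ∎
  where
  +-comm-indicator : ∀ x y → indicator (x + y ≤? N) ≡ indicator (y + x ≤? N)
  +-comm-indicator x y = indicator-cong (subst (_≤ N) (+-comm x y)) (subst (_≤ N) (+-comm y x)) _ _

unroll-linear-recurrence : ∀ c (u v : ℕ → ℕ) → u 0 ≡ v 0 → (∀ N → u (suc N) ≡ c * u N + v (suc N)) →
                           ∀ N → u N ≡ ∑[ s < suc N ] (c ^ s * v (N ∸ s))
unroll-linear-recurrence c u v u₀ uₛ zero    = trans u₀ (x≡1*x+0 (v 0))
  where
  x≡1*x+0 : ∀ x → x ≡ 1 * x + 0
  x≡1*x+0 = solve-∀
unroll-linear-recurrence c u v u₀ uₛ (suc N) = begin
  u (suc N)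
    ≡⟨ uₛ N ⟩
  c * u N + v (suc N)
    ≡⟨ cong (λ x → c * x + v (suc N)) (unroll-linear-recurrence c u v u₀ uₛ N) ⟩
  c * ∑[ s < suc N ] (c ^ s * v (N ∸ s)) + v (suc N)
    ≡⟨ cong (_+ v (suc N)) (∑-*ˡ (suc N) c (λ s → c ^ s * v (N ∸ s))) ⟨
  ∑[ s < suc N ] (c * (c ^ s * v (N ∸ s))) + v (suc N)
    ≡⟨ cong (_+ v (suc N)) (∑-cong (suc N) (λ s → *-assoc c (c ^ s) (v (N ∸ s)))) ⟨
  ∑[ s < suc N ] (c ^ suc s * v (N ∸ s)) + v (suc N)
    ≡⟨ +-comm _ (v (suc N)) ⟩
  v (suc N) + ∑[ s < suc N ] (c ^ suc s * v (N ∸ s))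
    ≡⟨ cong (_+ ∑[ s < suc N ] (c ^ suc s * v (N ∸ s))) (*-identityˡ (v (suc N))) ⟨
  ∑[ s < suc (suc N) ] (c ^ s * v (suc N ∸ s)) ∎

-- Sums over compositions

sumCompositions : (r N : ℕ) → (Vec ℕ r → ℕ) → ℕ
sumCompositions zero    zero    F = F []
sumCompositions zero    (suc N) F = 0
sumCompositions (suc r) N       F = ∑[ x < suc N ] sumCompositions r (N ∸ x) (λ t → F (x ∷ t))

sumCompositions-cong : ∀ r N {F G : Vec ℕ r → ℕ} → (∀ t → sum (toList t) ≡ N → F t ≡ G t) →
                       sumCompositions r N F ≡ sumCompositions r N G
sumCompositions-cong zero    zero    F≡G = F≡G [] refl
sumCompositions-cong zero    (suc N) F≡G = refl
sumCompositions-cong (suc r) N       F≡G = ∑-cong< (suc N) (λ x x≤N →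
  sumCompositions-cong r (N ∸ x) (λ t ∑t≡N∸x →
    F≡G (x ∷ t) (trans (cong (x +_) ∑t≡N∸x) (m+[n∸m]≡n (≤-pred x≤N)))))

sumCompositions-*ˡ : ∀ r N c (F : Vec ℕ r → ℕ) → sumCompositions r N (λ t → c * F t) ≡ c * sumCompositions r N F
sumCompositions-*ˡ zero    zero    c F = refl
sumCompositions-*ˡ zero    (suc N) c F = sym (*-zeroʳ c)
sumCompositions-*ˡ (suc r) N       c F = trans
  (∑-cong (suc N) (λ x → sumCompositions-*ˡ r (N ∸ x) c (λ t → F (x ∷ t))))
  (∑-*ˡ (suc N) c (λ x → sumCompositions r (N ∸ x) (λ t → F (x ∷ t))))

sumCompositions-∷ʳ : ∀ r N (F : Vec ℕ (suc r) → ℕ) →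
  sumCompositions (suc r) N F ≡ ∑[ s < suc N ] sumCompositions r (N ∸ s) (λ t → F (t ∷ʳ s))
sumCompositions-∷ʳ zero    N F = ∑-cong (suc N) (λ x → single (N ∸ x) x)
  where
  single : ∀ M x → sumCompositions zero M (λ t → F (x ∷ t)) ≡ sumCompositions zero M (λ t → F (t ∷ʳ x))
  single zero    x = refl
  single (suc M) x = refl
sumCompositions-∷ʳ (suc r) N F = begin
  ∑[ x < suc N ] sumCompositions (suc r) (N ∸ x) (λ t → F (x ∷ t))
    ≡⟨ ∑-cong (suc N) (λ x → sumCompositions-∷ʳ r (N ∸ x) (λ t → F (x ∷ t))) ⟩
  ∑[ x < suc N ] ∑[ s < suc (N ∸ x) ] sumCompositions r (N ∸ x ∸ s) (λ t → F (x ∷ (t ∷ʳ s)))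
    ≡⟨ ∑-triangle-comm N (λ x s → sumCompositions r (N ∸ x ∸ s) (λ t → F (x ∷ (t ∷ʳ s)))) ⟩
  ∑[ s < suc N ] ∑[ x < suc (N ∸ s) ] sumCompositions r (N ∸ x ∸ s) (λ t → F (x ∷ (t ∷ʳ s)))
    ≡⟨ ∑-cong (suc N) (λ s → ∑-cong (suc (N ∸ s)) (λ x →
         cong (λ M → sumCompositions r M (λ t → F (x ∷ (t ∷ʳ s)))) (∸-∸-comm N x s))) ⟩
  ∑[ s < suc N ] ∑[ x < suc (N ∸ s) ] sumCompositions r (N ∸ s ∸ x) (λ t → F (x ∷ (t ∷ʳ s))) ∎
  where
  ∸-∸-comm : ∀ N x s → N ∸ x ∸ s ≡ N ∸ s ∸ x
  ∸-∸-comm N x s = trans (∸-+-assoc N x s) (trans (cong (N ∸_) (+-comm x s)) (sym (∸-+-assoc N s x)))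

sum-map-boundedVecs : ∀ r B N (F : Vec ℕ r → ℕ) → N ≤ B →
  sum (map (λ t → indicator (sum (toList t) ≟ N) * F t) (boundedVecs r B)) ≡ sumCompositions r N F
sum-map-boundedVecs zero    B zero    F _ = trans (+-identityʳ _) (+-identityʳ (F []))
sum-map-boundedVecs zero    B (suc N) F _ = refl
sum-map-boundedVecs (suc r) B N       F N≤B = begin
  sum (map φ (concatMap (λ x → map (x ∷_) (boundedVecs r B)) (upTo (suc B))))
    ≡⟨ cong (sum ∘ map φ) (concatMap≡cartesianProductWith _∷_ (upTo (suc B)) (boundedVecs r B)) ⟩
  sum (map φ (cartesianProductWith _∷_ (upTo (suc B)) (boundedVecs r B)))
    ≡⟨ sum-map-cartesianProductWith _∷_ φ (upTo (suc B)) (boundedVecs r B) ⟩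
  sum (map row (upTo (suc B)))
    ≡⟨ sum-map-applyUpTo (suc B) row (λ x → x) ⟩
  ∑< (suc B) row
    ≡⟨ ∑-vanishing-tail (suc N) (suc B) row (s≤s N≤B) row-vanishes ⟩
  ∑< (suc N) row
    ≡⟨ ∑-cong< (suc N) (λ x x≤N → row≡ x (≤-pred x≤N)) ⟩
  ∑[ x < suc N ] sumCompositions r (N ∸ x) (λ t → F (x ∷ t)) ∎
  where
  φ : Vec ℕ (suc r) → ℕ
  φ t = indicator (sum (toList t) ≟ N) * F t
  row : ℕ → ℕ
  row x = sum (map (λ t → φ (x ∷ t)) (boundedVecs r B))
  row-vanishes : ∀ x → suc N ≤ x → row x ≡ 0
  row-vanishes x N<x = trans
    (cong sum (map-cong (λ t → cong (_* F (x ∷ t)) (indicator-no (x + sum (toList t) ≟ N)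
       (λ x+s≡N → <⇒≱ N<x (subst (x ≤_) x+s≡N (m≤m+n x _))))) (boundedVecs r B)))
    (sum-map-*ˡ 0 (λ t → F (x ∷ t)) (boundedVecs r B))
  row≡ : ∀ x → x ≤ N → row x ≡ sumCompositions r (N ∸ x) (λ t → F (x ∷ t))
  row≡ x x≤N = trans
    (cong sum (map-cong (λ t → cong (_* F (x ∷ t)) (indicator-cong
       (λ x+s≡N → trans (sym (m+n∸m≡n x _)) (cong (_∸ x) x+s≡N))
       (λ s≡N∸x → trans (cong (x +_) s≡N∸x) (m+[n∸m]≡n x≤N))
       (x + sum (toList t) ≟ N) (sum (toList t) ≟ N ∸ x))) (boundedVecs r B)))
    (sum-map-boundedVecs r B (N ∸ x) (λ t → F (x ∷ t)) (≤-trans (m∸n≤m N x) N≤B))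

sum-map-compositions : ∀ r N (F : Vec ℕ r → ℕ) → sum (map F (compositions r N)) ≡ sumCompositions r N F
sum-map-compositions r N F =
  trans (sum-map-filter (λ t → sum (toList t) ≟ N) F (boundedVecs r N)) (sum-map-boundedVecs r N N F ≤-refl)

-- The right-hand side

product-map-allFin-last : ∀ n (f : Fin (suc n) → ℕ) →
  product (map f (allFin (suc n))) ≡ product (map (f ∘ inject₁) (allFin n)) * f (fromℕ n)
product-map-allFin-last n f = begin
  product (map f (allFin (suc n)))
    ≡⟨ cong product (map-tabulate (λ i → i) f) ⟩
  product (tabulate f)
    ≡⟨ product-tabulate-last n f ⟩
  product (tabulate (f ∘ inject₁)) * f (fromℕ n)
    ≡⟨ cong (λ xs → product xs * f (fromℕ n)) (map-tabulate (λ i → i) (f ∘ inject₁)) ⟨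
  product (map (f ∘ inject₁) (allFin n)) * f (fromℕ n) ∎
  where
  product-tabulate-last : ∀ n (f : Fin (suc n) → ℕ) →
                          product (tabulate f) ≡ product (tabulate (f ∘ inject₁)) * f (fromℕ n)
  product-tabulate-last zero    f = *-comm (f fzero) 1
  product-tabulate-last (suc n) f =
    trans (cong (f fzero *_) (product-tabulate-last n (f ∘ fsuc))) (sym (*-assoc (f fzero) _ _))

module _ {A : Set} where

  lookup-∷ʳ-inject₁ : ∀ {n} (t : Vec A n) x (i : Fin n) → lookup (t ∷ʳ x) (inject₁ i) ≡ lookup t i
  lookup-∷ʳ-inject₁ (y ∷ t) x fzero    = refl
  lookup-∷ʳ-inject₁ (y ∷ t) x (fsuc i) = lookup-∷ʳ-inject₁ t x i

  lookup-∷ʳ-fromℕ : ∀ {n} (t : Vec A n) x → lookup (t ∷ʳ x) (fromℕ n) ≡ x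
  lookup-∷ʳ-fromℕ []      x = refl
  lookup-∷ʳ-fromℕ (y ∷ t) x = lookup-∷ʳ-fromℕ t x

  take-toList-∷ʳ : ∀ {n k} (t : Vec A n) x → k ≤ n → take k (toList (t ∷ʳ x)) ≡ take k (toList t)
  take-toList-∷ʳ t       x z≤n       = refl
  take-toList-∷ʳ (y ∷ t) x (s≤s k≤n) = cong (y ∷_) (take-toList-∷ʳ t x k≤n)

powerPart-∷ʳ : ∀ {r} (t : Vec ℕ r) s → powerPart (t ∷ʳ s) ≡ powerPart t * suc r ^ s
powerPart-∷ʳ {r} t s = begin
  powerPart (t ∷ʳ s)
    ≡⟨ product-map-allFin-last r factor ⟩
  product (map (factor ∘ inject₁) (allFin r)) * factor (fromℕ r)
    ≡⟨ cong₂ _*_ (cong product (map-cong earlier (allFin r))) last ⟩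
  powerPart t * suc r ^ s ∎
  where
  factor : Fin (suc r) → ℕ
  factor i = suc (toℕ i) ^ lookup (t ∷ʳ s) i
  earlier : ∀ i → factor (inject₁ i) ≡ suc (toℕ i) ^ lookup t i
  earlier i = cong₂ (λ j e → suc j ^ e) (toℕ-inject₁ i) (lookup-∷ʳ-inject₁ t s i)
  last : factor (fromℕ r) ≡ suc r ^ s
  last = cong₂ (λ j e → suc j ^ e) (toℕ-fromℕ r) (lookup-∷ʳ-fromℕ t s)

weight : (m j S : ℕ) → ℕ
weight m j S = m * S + j * (m ∸ 1) + 1

prodPart-∷ʳ : ∀ m d (t : Vec ℕ (suc d)) s →
              prodPart m (suc d) (t ∷ʳ s) ≡ prodPart m d t * weight m (suc d) (sum (toList t))
prodPart-∷ʳ m d t s = begin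
  prodPart m (suc d) (t ∷ʳ s)
    ≡⟨ product-map-allFin-last d factor ⟩
  product (map (factor ∘ inject₁) (allFin d)) * factor (fromℕ d)
    ≡⟨ cong₂ _*_ (cong product (map-cong earlier (allFin d))) last ⟩
  prodPart m d t * weight m (suc d) (sum (toList t)) ∎
  where
  factor : Fin (suc d) → ℕ
  factor j = weight m (suc (toℕ j)) (sum (take (suc (toℕ j)) (toList (t ∷ʳ s))))
  earlier : ∀ i → factor (inject₁ i) ≡ weight m (suc (toℕ i)) (sum (take (suc (toℕ i)) (toList t)))
  earlier i rewrite toℕ-inject₁ i =
    cong (weight m (suc (toℕ i)) ∘ sum) (take-toList-∷ʳ t s (m≤n⇒m≤1+n (toℕ<n i)))
  last : factor (fromℕ d) ≡ weight m (suc d) (sum (toList t))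
  last rewrite toℕ-fromℕ d = cong (weight m (suc d) ∘ sum)
    (trans (take-toList-∷ʳ t s ≤-refl) (take-all (suc d) (toList t) (≤-reflexive (length-toList t))))

rhsTerm : (m d : ℕ) → Vec ℕ (suc d) → ℕ
rhsTerm m d t = powerPart t * prodPart m d t

sumCompositions-rhsTerm-zero : ∀ m N → sumCompositions 1 N (rhsTerm m 0) ≡ 1
sumCompositions-rhsTerm-zero m N = begin
  sumCompositions 1 N (rhsTerm m 0) ≡⟨ one-part N (λ x → 1 ^ x * 1 * 1) ⟩
  1 ^ N * 1 * 1                     ≡⟨ trans (*-identityʳ _) (*-identityʳ _) ⟩
  1 ^ N                             ≡⟨ ^-zeroˡ N ⟩
  1                                 ∎
  where
  one-part : ∀ N (g : ℕ → ℕ) → ∑[ x < suc N ] sumCompositions 0 (N ∸ x) (λ _ → g x) ≡ g N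
  one-part zero    g = +-identityʳ (g 0)
  one-part (suc N) g = one-part N (λ x → g (suc x))

rhsTerm-∷ʳ : ∀ m d (t : Vec ℕ (suc d)) s →
  rhsTerm m (suc d) (t ∷ʳ s) ≡ suc (suc d) ^ s * (weight m (suc d) (sum (toList t)) * rhsTerm m d t)
rhsTerm-∷ʳ m d t s = trans (cong₂ _*_ (powerPart-∷ʳ t s) (prodPart-∷ʳ m d t s))
  (regroup (powerPart t) (suc (suc d) ^ s) (prodPart m d t) (weight m (suc d) (sum (toList t))))
  where
  regroup : ∀ a b c w → a * b * (c * w) ≡ b * (w * (a * c))
  regroup = solve-∀

sumCompositions-rhsTerm-suc : ∀ m d N → sumCompositions (suc (suc d)) N (rhsTerm m (suc d)) ≡
  ∑[ s < suc N ] (suc (suc d) ^ s * (weight m (suc d) (N ∸ s) * sumCompositions (suc d) (N ∸ s) (rhsTerm m d)))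
sumCompositions-rhsTerm-suc m d N = trans (sumCompositions-∷ʳ (suc d) N (rhsTerm m (suc d))) (∑-cong (suc N) (λ s → begin
  sumCompositions (suc d) (N ∸ s) (λ t → rhsTerm m (suc d) (t ∷ʳ s))
    ≡⟨ sumCompositions-cong (suc d) (N ∸ s) (λ t ∑t≡N∸s →
         trans (rhsTerm-∷ʳ m d t s) (cong (λ S → suc (suc d) ^ s * (weight m (suc d) S * rhsTerm m d t)) ∑t≡N∸s)) ⟩
  sumCompositions (suc d) (N ∸ s) (λ t → suc (suc d) ^ s * (weight m (suc d) (N ∸ s) * rhsTerm m d t))
    ≡⟨ sumCompositions-*ˡ (suc d) (N ∸ s) (suc (suc d) ^ s) (λ t → weight m (suc d) (N ∸ s) * rhsTerm m d t) ⟩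
  suc (suc d) ^ s * sumCompositions (suc d) (N ∸ s) (λ t → weight m (suc d) (N ∸ s) * rhsTerm m d t)
    ≡⟨ cong (suc (suc d) ^ s *_) (sumCompositions-*ˡ (suc d) (N ∸ s) (weight m (suc d) (N ∸ s)) (rhsTerm m d)) ⟩
  suc (suc d) ^ s * (weight m (suc d) (N ∸ s) * sumCompositions (suc d) (N ∸ s) (rhsTerm m d)) ∎))

-- Words as lists

variable
  n L : ℕ

descentFlag : Fin n → Fin n → ℕ
descentFlag x y = indicator (toℕ y <? toℕ x)

descentsˡ : List (Fin n) → ℕ
descentsˡ []          = 0
descentsˡ (x ∷ [])    = 0
descentsˡ (x ∷ y ∷ w) = descentFlag x y + descentsˡ (y ∷ w)

occurrences : Fin n → List (Fin n) → ℕ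
occurrences i []      = 0
occurrences i (x ∷ w) = indicator (x ≟ᶠ i) + occurrences i w

-- The Stirling condition organised by the first index u of a triple u < v < w: the letter
-- at u bounds every letter that precedes a later copy of it.
Bounds : Fin n → List (Fin n) → Set
Bounds x []      = ⊤
Bounds x (y ∷ w) = (x ∈ w → toℕ y ≤ toℕ x) × Bounds x w

IsStirling : List (Fin n) → Set
IsStirling []      = ⊤
IsStirling (x ∷ w) = Bounds x w × IsStirling w

descents-toList : (a : Vec (Fin n) L) → descents a ≡ descentsˡ (toList a)
descents-toList []          = refl
descents-toList (x ∷ [])    = refl
descents-toList (x ∷ y ∷ a) = cong (descentFlag x y +_) (descents-toList (y ∷ a))

count-toList : (i : Fin n) (a : Vec (Fin n) L) → count (_≟ᶠ i) a ≡ occurrences i (toList a)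
count-toList i []      = refl
count-toList i (x ∷ a) with x ≟ᶠ i
... | yes _ = cong suc (count-toList i a)
... | no _  = count-toList i a

BoundsAt : Fin n → Vec (Fin n) L → Set
BoundsAt {L = L} x a = (v w : Fin L) → toℕ v < toℕ w → lookup a w ≡ x → toℕ (lookup a v) ≤ toℕ x

BoundsAt⇔Bounds : (x : Fin n) (a : Vec (Fin n) L) → BoundsAt x a ⇔ Bounds x (toList a)
BoundsAt⇔Bounds x a = mk⇔ (to a) (from a)
  where
  to : ∀ {L} (a : Vec (Fin _) L) → BoundsAt x a → Bounds x (toList a)
  to []      _ = tt
  to (y ∷ a) h = (λ x∈a → let v = ∈-toList⁻ x∈a in h fzero (fsuc (index v)) (s≤s z≤n) (sym (lookup-index v)))
               , to a (λ v w v<w → h (fsuc v) (fsuc w) (s≤s v<w))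
  from : ∀ {L} (a : Vec (Fin _) L) → Bounds x (toList a) → BoundsAt x a
  from (y ∷ a) (h , _) fzero    (fsuc w) _         refl = h (∈-toList⁺ (∈-lookup w a))
  from (y ∷ a) (_ , h) (fsuc v) (fsuc w) (s≤s v<w) eq   = from a h v w v<w eq

IsStirlingCond⇔IsStirling : (a : Vec (Fin n) L) → IsStirlingCond a ⇔ IsStirling (toList a)
IsStirlingCond⇔IsStirling a = mk⇔ (to a) (from a)
  where
  to : ∀ {L} (a : Vec (Fin _) L) → IsStirlingCond a → IsStirling (toList a)
  to []      _ = tt
  to (x ∷ a) s =
    Equivalence.to (BoundsAt⇔Bounds x a) (λ v w v<w eq → s fzero (fsuc v) (fsuc w) (s≤s z≤n) (s≤s v<w) (sym eq)) ,
    to a (λ u v w u<v v<w → s (fsuc u) (fsuc v) (fsuc w) (s≤s u<v) (s≤s v<w))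
  from : ∀ {L} (a : Vec (Fin _) L) → IsStirling (toList a) → IsStirlingCond a
  from (x ∷ a) (h , _) fzero    (fsuc v) (fsuc w) _         (s≤s v<w) eq =
    Equivalence.from (BoundsAt⇔Bounds x a) h v w v<w (sym eq)
  from (x ∷ a) (_ , s) (fsuc u) (fsuc v) (fsuc w) (s≤s u<v) (s≤s v<w) eq = from a s u v w u<v v<w eq

StirlingWith : (m k : ℕ) → Vec (Fin n) L → Set
StirlingWith m k a = (IsMultisetPerm m a × IsStirlingCond a) × descents a ≡ k

isStirlingWord? : (m : ℕ) (a : Vec (Fin n) L) → Dec (IsMultisetPerm m a × IsStirlingCond a)
isStirlingWord? m a = isMultisetPerm? m a ×-dec isStirlingCond? a

stirlingWith? : (m k : ℕ) (a : Vec (Fin n) L) → Dec (StirlingWith m k a)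
stirlingWith? m k a = isStirlingWord? m a ×-dec (descents a ≟ k)

StirlingWithˡ : (m k : ℕ) → List (Fin n) → Set
StirlingWithˡ m k w = ((∀ i → occurrences i w ≡ m) × IsStirling w) × descentsˡ w ≡ k

StirlingWith⇔StirlingWithˡ : ∀ m k (a : Vec (Fin n) L) → StirlingWith m k a ⇔ StirlingWithˡ m k (toList a)
StirlingWith⇔StirlingWithˡ m k a = mk⇔
  (λ ((mult , stir) , des) →
     ((λ i → trans (sym (count-toList i a)) (mult i)) , Equivalence.to (IsStirlingCond⇔IsStirling a) stir) ,
     trans (sym (descents-toList a)) des)
  (λ ((mult , stir) , des) →
     ((λ i → trans (count-toList i a) (mult i)) , Equivalence.from (IsStirlingCond⇔IsStirling a) stir) ,
     trans (descents-toList a) des)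

StirlingWith-fromList⇔ : ∀ m k (w : List (Fin n)) → StirlingWith m k (fromList w) ⇔ StirlingWithˡ m k w
StirlingWith-fromList⇔ m k w = mk⇔
  (λ s → subst (StirlingWithˡ m k) (toList∘fromList w) (Equivalence.to via s))
  (λ s → Equivalence.from via (subst (StirlingWithˡ m k) (sym (toList∘fromList w)) s))
  where
  via : StirlingWith m k (fromList w) ⇔ StirlingWithˡ m k (toList (fromList w))
  via = StirlingWith⇔StirlingWithˡ m k (fromList w)

countStirling : (m n L k : ℕ) → ℕ
countStirling m n L k = length (filter (stirlingWith? m k) (allWords n L))

allWords-unique : ∀ n L → Unique (allWords n L)
allWords-unique n zero    = [] ∷ []
allWords-unique n (suc L) = subst Unique (sym (concatMap≡cartesianProductWith _∷_ (allFin n) (allWords n L)))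
  (cartesianProductWith⁺ _∷_ ∷-injectiveᵛ (allFin⁺ n) (allWords-unique n L))

∈-allWords : (a : Vec (Fin n) L) → a ∈ allWords n L
∈-allWords []      = here refl
∈-allWords {n} {suc L} (x ∷ a) = subst (x ∷ a ∈_) (sym (concatMap≡cartesianProductWith _∷_ (allFin n) (allWords n L)))
  (∈-cartesianProductWith⁺ _∷_ (∈-allFin x) (∈-allWords a))

toList-cast-fromList : {A : Set} (w : List A) (eq : length w ≡ L) → toList (cast eq (fromList w)) ≡ w
toList-cast-fromList w eq = trans (toList-cast eq (fromList w)) (toList∘fromList w)

descents≤ : (a : Vec (Fin n) (suc L)) → descents a ≤ L
descents≤ (x ∷ [])    = z≤n
descents≤ (x ∷ y ∷ a) = +-mono-≤ (indicator≤1 (toℕ y <? toℕ x)) (descents≤ (y ∷ a))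

occurrences≤length : (i : Fin n) (w : List (Fin n)) → occurrences i w ≤ length w
occurrences≤length i []      = z≤n
occurrences≤length i (x ∷ w) = +-mono-≤ (indicator≤1 (x ≟ᶠ i)) (occurrences≤length i w)

-- Inserting a block of least letters

descentFlag-suc : (x y : Fin n) → descentFlag (fsuc x) (fsuc y) ≡ descentFlag x y
descentFlag-suc x y = indicator-cong ≤-pred s≤s (suc (toℕ y) <? suc (toℕ x)) (toℕ y <? toℕ x)

zeros++suc : ℕ → List (Fin n) → List (Fin (suc n))
zeros++suc c b = replicate c fzero ++ map fsuc b

module _ {x : Fin n} where

  ∈-zeros++suc⁻ : ∀ c b → fsuc x ∈ zeros++suc c b → x ∈ b
  ∈-zeros++suc⁻ (suc c) b       (there x∈) = ∈-zeros++suc⁻ c b x∈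
  ∈-zeros++suc⁻ zero    (y ∷ b) (here eq)  = here (fsuc-injective eq)
  ∈-zeros++suc⁻ zero    (y ∷ b) (there x∈) = there (∈-zeros++suc⁻ zero b x∈)

  ∈-zeros++suc⁺ : ∀ c b → x ∈ b → fsuc x ∈ zeros++suc c b
  ∈-zeros++suc⁺ (suc c) b x∈b = there (∈-zeros++suc⁺ c b x∈b)
  ∈-zeros++suc⁺ zero    b x∈b = ∈-map⁺ fsuc x∈b

  Bounds-zeros++suc : ∀ c b → Bounds (fsuc x) (zeros++suc c b) ⇔ Bounds x b
  Bounds-zeros++suc (suc c) b = mk⇔ (λ (_ , h) → Equivalence.to (Bounds-zeros++suc c b) h)
                                    (λ h → (λ _ → z≤n) , Equivalence.from (Bounds-zeros++suc c b) h)
  Bounds-zeros++suc zero [] = mk⇔ (λ _ → tt) (λ _ → tt)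
  Bounds-zeros++suc zero (y ∷ b) = mk⇔
    (λ (h , hs) → (λ x∈b → ≤-pred (h (∈-map⁺ fsuc x∈b))) , Equivalence.to (Bounds-zeros++suc zero b) hs)
    (λ (h , hs) → (λ x∈b → s≤s (h (∈-zeros++suc⁻ zero b x∈b))) , Equivalence.from (Bounds-zeros++suc zero b) hs)

zero∉map-suc : (b : List (Fin n)) → ¬ (fzero ∈ map fsuc b)
zero∉map-suc (y ∷ b) (there 0∈) = zero∉map-suc b 0∈

Bounds-zero-zeros++suc : ∀ c (b : List (Fin n)) → Bounds fzero (zeros++suc c b)
Bounds-zero-zeros++suc (suc c) b       = (λ _ → z≤n) , Bounds-zero-zeros++suc c b
Bounds-zero-zeros++suc zero    []      = tt
Bounds-zero-zeros++suc zero    (y ∷ b) = (λ 0∈ → ⊥-elim (zero∉map-suc b 0∈)) , Bounds-zero-zeros++suc zero b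

IsStirling-zeros++suc : ∀ c (b : List (Fin n)) → IsStirling (zeros++suc c b) ⇔ IsStirling b
IsStirling-zeros++suc (suc c) b = mk⇔ (λ (_ , s) → Equivalence.to (IsStirling-zeros++suc c b) s)
                                      (λ s → Bounds-zero-zeros++suc c b , Equivalence.from (IsStirling-zeros++suc c b) s)
IsStirling-zeros++suc zero [] = mk⇔ (λ _ → tt) (λ _ → tt)
IsStirling-zeros++suc zero (y ∷ b) = mk⇔
  (λ (h , s) → Equivalence.to (Bounds-zeros++suc zero b) h , Equivalence.to (IsStirling-zeros++suc zero b) s)
  (λ (h , s) → Equivalence.from (Bounds-zeros++suc zero b) h , Equivalence.from (IsStirling-zeros++suc zero b) s)

occurrences-zeros++suc-zero : ∀ c (b : List (Fin n)) → occurrences fzero (zeros++suc c b) ≡ c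
occurrences-zeros++suc-zero (suc c) b       = cong suc (occurrences-zeros++suc-zero c b)
occurrences-zeros++suc-zero zero    []      = refl
occurrences-zeros++suc-zero zero    (y ∷ b) = occurrences-zeros++suc-zero zero b

occurrences-zeros++suc-suc : ∀ (i : Fin n) c b → occurrences (fsuc i) (zeros++suc c b) ≡ occurrences i b
occurrences-zeros++suc-suc i (suc c) b       = occurrences-zeros++suc-suc i c b
occurrences-zeros++suc-suc i zero    []      = refl
occurrences-zeros++suc-suc i zero    (y ∷ b) =
  cong₂ _+_ (indicator-cong fsuc-injective (cong fsuc) (fsuc y ≟ᶠ fsuc i) (y ≟ᶠ i)) (occurrences-zeros++suc-suc i zero b)

descents-zeros++suc : ∀ c (b : List (Fin n)) → descentsˡ (zeros++suc c b) ≡ descentsˡ b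
descents-zeros++suc (suc (suc c)) b           = descents-zeros++suc (suc c) b
descents-zeros++suc (suc zero)    []          = refl
descents-zeros++suc (suc zero)    (y ∷ b)     = descents-zeros++suc zero (y ∷ b)
descents-zeros++suc zero          []          = refl
descents-zeros++suc zero          (x ∷ [])    = refl
descents-zeros++suc zero          (x ∷ y ∷ b) = cong₂ _+_ (descentFlag-suc x y) (descents-zeros++suc zero (y ∷ b))

length-zeros++suc : ∀ c (b : List (Fin n)) → length (zeros++suc c b) ≡ c + length b
length-zeros++suc c b = trans (length-++ (replicate c fzero)) (cong₂ _+_ (length-replicate c) (length-map fsuc b))

∉⇒map-suc : (w : List (Fin (suc n))) → ¬ (fzero ∈ w) → ∃ λ b → w ≡ map fsuc b
∉⇒map-suc []           _  = [] , refl
∉⇒map-suc (fzero ∷ w)  0∉ = ⊥-elim (0∉ (here refl))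
∉⇒map-suc (fsuc y ∷ w) 0∉ with ∉⇒map-suc w (0∉ ∘ there)
... | b , refl = y ∷ b , refl

Bounds-zero⇒zeros++suc : (w : List (Fin (suc n))) → Bounds fzero w → ∃ λ c → ∃ λ b → w ≡ zeros++suc c b
Bounds-zero⇒zeros++suc []           _       = 0 , [] , refl
Bounds-zero⇒zeros++suc (fzero ∷ w)  (_ , h) with Bounds-zero⇒zeros++suc w h
... | c , b , refl = suc c , b , refl
Bounds-zero⇒zeros++suc (fsuc y ∷ w) (h , _) with ∉⇒map-suc w (n≮0 ∘ h)
... | b , refl = 0 , y ∷ b , refl

-- The number of descents created by inserting the block before position j: none at the
-- front or inside a descent, one anywhere else.
descentGain : Vec (Fin n) L → Fin (suc L) → ℕ
descentGain a           fzero           = 0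
descentGain (x ∷ [])    (fsuc fzero)    = 1
descentGain (x ∷ y ∷ a) (fsuc fzero)    = 1 ∸ descentFlag x y
descentGain (x ∷ a)     (fsuc (fsuc j)) = descentGain a (fsuc j)

-- The multiplicity is suc m from here on: the inserted block must be non-empty.
module _ (m : ℕ) where

  insert : Vec (Fin n) L → Fin (suc L) → List (Fin (suc n))
  insert a       fzero    = zeros++suc (suc m) (toList a)
  insert (x ∷ a) (fsuc j) = fsuc x ∷ insert a j

  length-insert : (a : Vec (Fin n) L) (j : Fin (suc L)) → length (insert a j) ≡ suc m + L
  length-insert a fzero = trans (length-zeros++suc (suc m) (toList a)) (cong (suc m +_) (length-toList a))
  length-insert (x ∷ a) (fsuc j) = trans (cong suc (length-insert a j)) (sym (+-suc (suc m) _))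

  occurrences-insert-zero : (a : Vec (Fin n) L) (j : Fin (suc L)) → occurrences fzero (insert a j) ≡ suc m
  occurrences-insert-zero a       fzero    = occurrences-zeros++suc-zero (suc m) (toList a)
  occurrences-insert-zero (x ∷ a) (fsuc j) = occurrences-insert-zero a j

  occurrences-insert-suc : (i : Fin n) (a : Vec (Fin n) L) (j : Fin (suc L)) →
                           occurrences (fsuc i) (insert a j) ≡ occurrences i (toList a)
  occurrences-insert-suc i a       fzero    = occurrences-zeros++suc-suc i (suc m) (toList a)
  occurrences-insert-suc i (x ∷ a) (fsuc j) =
    cong₂ _+_ (indicator-cong fsuc-injective (cong fsuc) (fsuc x ≟ᶠ fsuc i) (x ≟ᶠ i)) (occurrences-insert-suc i a j)

  module _ {x : Fin n} where

    ∈-insert⁻ : (a : Vec (Fin n) L) (j : Fin (suc L)) → fsuc x ∈ insert a j → x ∈ toList a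
    ∈-insert⁻ a       fzero    x∈ = ∈-zeros++suc⁻ (suc m) (toList a) x∈
    ∈-insert⁻ (y ∷ a) (fsuc j) (here eq) = here (fsuc-injective eq)
    ∈-insert⁻ (y ∷ a) (fsuc j) (there x∈) = there (∈-insert⁻ a j x∈)

    ∈-insert⁺ : (a : Vec (Fin n) L) (j : Fin (suc L)) → x ∈ toList a → fsuc x ∈ insert a j
    ∈-insert⁺ a       fzero    x∈a         = ∈-zeros++suc⁺ (suc m) (toList a) x∈a
    ∈-insert⁺ (y ∷ a) (fsuc j) (here eq)   = here (cong fsuc eq)
    ∈-insert⁺ (y ∷ a) (fsuc j) (there x∈a) = there (∈-insert⁺ a j x∈a)

    Bounds-insert : (a : Vec (Fin n) L) (j : Fin (suc L)) → Bounds (fsuc x) (insert a j) ⇔ Bounds x (toList a)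
    Bounds-insert a       fzero    = Bounds-zeros++suc (suc m) (toList a)
    Bounds-insert (y ∷ a) (fsuc j) = mk⇔
      (λ (h , hs) → (λ x∈a → ≤-pred (h (∈-insert⁺ a j x∈a))) , Equivalence.to (Bounds-insert a j) hs)
      (λ (h , hs) → (λ x∈ → s≤s (h (∈-insert⁻ a j x∈))) , Equivalence.from (Bounds-insert a j) hs)

  IsStirling-insert : (a : Vec (Fin n) L) (j : Fin (suc L)) → IsStirling (insert a j) ⇔ IsStirling (toList a)
  IsStirling-insert a       fzero    = IsStirling-zeros++suc (suc m) (toList a)
  IsStirling-insert (x ∷ a) (fsuc j) = mk⇔
    (λ (h , s) → Equivalence.to (Bounds-insert a j) h , Equivalence.to (IsStirling-insert a j) s)
    (λ (h , s) → Equivalence.from (Bounds-insert a j) h , Equivalence.from (IsStirling-insert a j) s)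

  descents-insert : (a : Vec (Fin n) L) (j : Fin (suc L)) → descentsˡ (insert a j) ≡ descentGain a j + descents a
  descents-insert a fzero = trans (descents-zeros++suc (suc m) (toList a)) (sym (descents-toList a))
  descents-insert (x ∷ []) (fsuc fzero) = cong suc (descents-zeros++suc (suc m) [])
  descents-insert (x ∷ y ∷ a) (fsuc fzero) = begin
    suc (descentsˡ (zeros++suc (suc m) (y ∷ toList a)))  ≡⟨ cong suc (descents-zeros++suc (suc m) (y ∷ toList a)) ⟩
    suc (descentsˡ (y ∷ toList a))                       ≡⟨ cong suc (descents-toList (y ∷ a)) ⟨
    suc (descents (y ∷ a))                               ≡⟨ flag-split (toℕ y <? toℕ x) ⟩
    1 ∸ descentFlag x y + (descentFlag x y + descents (y ∷ a)) ∎
    where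
    flag-split : ∀ {P : Set} (P? : Dec P) → suc (descents (y ∷ a)) ≡ 1 ∸ indicator P? + (indicator P? + descents (y ∷ a))
    flag-split (yes _) = refl
    flag-split (no _)  = refl
  descents-insert (x ∷ y ∷ a) (fsuc (fsuc j)) = begin
    descentFlag (fsuc x) (fsuc y) + descentsˡ (insert (y ∷ a) (fsuc j))
      ≡⟨ cong₂ _+_ (descentFlag-suc x y) (descents-insert (y ∷ a) (fsuc j)) ⟩
    descentFlag x y + (descentGain (y ∷ a) (fsuc j) + descents (y ∷ a))
      ≡⟨ x∙yz≈y∙xz (descentFlag x y) (descentGain (y ∷ a) (fsuc j)) (descents (y ∷ a)) ⟩
    descentGain (y ∷ a) (fsuc j) + (descentFlag x y + descents (y ∷ a)) ∎

  insert-injective : {a a′ : Vec (Fin n) L} {j j′ : Fin (suc L)} → insert a j ≡ insert a′ j′ → a ≡ a′ × j ≡ j′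
  insert-injective {a = a} {a′} {fzero} {fzero} eq =
    trans (sym (cast-is-id refl a)) (toList-injective refl a a′
      (map-injective fsuc-injective (++-cancelˡ (replicate (suc m) fzero) _ _ eq))) , refl
  insert-injective {a = _ ∷ _} {_}       {fsuc _} {fzero}  ()
  insert-injective {a = _}     {_ ∷ _}   {fzero}  {fsuc _} ()
  insert-injective {a = x ∷ a} {x′ ∷ a′} {fsuc j} {fsuc j′} eq with ∷-injective eq
  ... | x≡x′ , rest with insert-injective {a = a} {a′} {j} {j′} rest
  ... | refl , refl = cong (_∷ a) (fsuc-injective x≡x′) , refl

  insert-surjective : (w : List (Fin (suc n))) → length w ≡ suc m + L → occurrences fzero w ≡ suc m → IsStirling w →
                      ∃ λ (a : Vec (Fin n) L) → ∃ λ j → w ≡ insert a j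
  insert-surjective {L = L} (fzero ∷ w) len occ (bounds , _) with Bounds-zero⇒zeros++suc w bounds
  ... | c , b , refl with trans (sym (occurrences-zeros++suc-zero c b)) (suc-injective occ)
  ... | refl = cast length-b (fromList b) , fzero , cong (λ b → fzero ∷ zeros++suc m b) (sym (toList-cast-fromList b length-b))
    where
    length-b : length b ≡ L
    length-b = +-cancelˡ-≡ m _ _ (trans (sym (length-zeros++suc m b)) (suc-injective len))
  insert-surjective {L = zero} (fsuc x ∷ w) len occ _ = ⊥-elim (1+n≰n (subst (_≤ m) occ occurrences≤m))
    where
    occurrences≤m : occurrences fzero w ≤ m
    occurrences≤m = subst (occurrences fzero w ≤_) (trans (suc-injective len) (+-identityʳ m)) (occurrences≤length fzero w)
  insert-surjective {L = suc L} (fsuc x ∷ w) len occ (_ , stirling)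
    with insert-surjective w (trans (suc-injective len) (+-suc m L)) occ stirling
  ... | a , j , refl = x ∷ a , fsuc j , refl

sum-tabulate-descentGain : ∀ (f : ℕ → ℕ) (a : Vec (Fin n) L) →
  sum (tabulate (f ∘ descentGain a)) ≡ suc (descents a) * f 0 + (L ∸ descents a) * f 1
sum-tabulate-descentGain f []       = x+0≡1*x+0*y (f 0) (f 1)
  where
  x+0≡1*x+0*y : ∀ x y → x + 0 ≡ 1 * x + 0 * y
  x+0≡1*x+0*y = solve-∀
sum-tabulate-descentGain f (x ∷ []) = x+[y+0]≡1*x+1*y (f 0) (f 1)
  where
  x+[y+0]≡1*x+1*y : ∀ x y → x + (y + 0) ≡ 1 * x + 1 * y
  x+[y+0]≡1*x+1*y = solve-∀
sum-tabulate-descentGain {L = suc (suc L)} f (x ∷ y ∷ a) =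
  by-flag (toℕ y <? toℕ x) (sum-tabulate-descentGain f (y ∷ a))
  where
  D : ℕ
  D = descents (y ∷ a)
  rest : ℕ
  rest = sum (tabulate (λ j → f (descentGain (y ∷ a) (fsuc j))))
  by-flag : ∀ {P : Set} (P? : Dec P) → f 0 + rest ≡ suc D * f 0 + (suc L ∸ D) * f 1 →
    f 0 + (f (1 ∸ indicator P?) + rest) ≡ suc (indicator P? + D) * f 0 + (suc (suc L) ∸ (indicator P? + D)) * f 1
  by-flag (yes _) IH = trans (cong (f 0 +_) IH) (sym (+-assoc (f 0) (suc D * f 0) _))
  by-flag (no _)  IH = begin
    f 0 + (f 1 + rest)
      ≡⟨ x∙yz≈y∙xz (f 0) (f 1) rest ⟩
    f 1 + (f 0 + rest)
      ≡⟨ cong (f 1 +_) IH ⟩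
    f 1 + (suc D * f 0 + (suc L ∸ D) * f 1)
      ≡⟨ regroup (f 1) (suc D * f 0) (suc L ∸ D) ⟩
    suc D * f 0 + suc (suc L ∸ D) * f 1
      ≡⟨ cong (λ e → suc D * f 0 + e * f 1) (+-∸-assoc 1 (m≤n⇒m≤1+n (descents≤ (y ∷ a)))) ⟨
    suc D * f 0 + (suc (suc L) ∸ D) * f 1 ∎
    where
    regroup : ∀ y x e → y + (x + e * y) ≡ x + suc e * y
    regroup = solve-∀

-- Counting by insertion

module _ (m k : ℕ) where

  stirlingWith?ˡ : (w : List (Fin (suc n))) → Dec (StirlingWith (suc m) k (fromList w))
  stirlingWith?ˡ w = stirlingWith? (suc m) k (fromList w)

  indicator-stirlingWith-insert : (a : Vec (Fin n) L) (j : Fin (suc L)) →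
    indicator (stirlingWith?ˡ (insert m a j)) ≡
    indicator (isStirlingWord? (suc m) a) * indicator (descentGain a j + descents a ≟ k)
  indicator-stirlingWith-insert a j = trans
    (indicator-cong to from (stirlingWith?ˡ w) (isStirlingWord? (suc m) a ×-dec (descentGain a j + descents a ≟ k)))
    (indicator-×-dec (isStirlingWord? (suc m) a) (descentGain a j + descents a ≟ k))
    where
    w : List (Fin (suc _))
    w = insert m a j
    to : StirlingWith (suc m) k (fromList w) →
         (IsMultisetPerm (suc m) a × IsStirlingCond a) × descentGain a j + descents a ≡ k
    to q with Equivalence.to (StirlingWith-fromList⇔ (suc m) k w) q
    ... | (occ , stir) , des =
      ((λ i → trans (count-toList i a) (trans (sym (occurrences-insert-suc m i a j)) (occ (fsuc i)))) ,
       Equivalence.from (IsStirlingCond⇔IsStirling a) (Equivalence.to (IsStirling-insert m a j) stir)) ,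
      trans (sym (descents-insert m a j)) des
    from : (IsMultisetPerm (suc m) a × IsStirlingCond a) × descentGain a j + descents a ≡ k →
           StirlingWith (suc m) k (fromList w)
    from ((mult , stir) , des) = Equivalence.from (StirlingWith-fromList⇔ (suc m) k w)
      ((occ , Equivalence.from (IsStirling-insert m a j) (Equivalence.to (IsStirlingCond⇔IsStirling a) stir)) ,
       trans (descents-insert m a j) des)
      where
      occ : ∀ i → occurrences i w ≡ suc m
      occ fzero    = occurrences-insert-zero m a j
      occ (fsuc i) = trans (occurrences-insert-suc m i a j) (trans (sym (count-toList i a)) (mult i))

  stirlingWords : (n L : ℕ) → List (List (Fin (suc n)))
  stirlingWords n L = map toList (filter (stirlingWith? (suc m) k) (allWords (suc n) (suc m + L)))

  insertions : (n L : ℕ) → List (List (Fin (suc n)))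
  insertions n L = cartesianProductWith (insert m) (allWords n L) (allFin (suc L))

  stirlingWord⇒insertion : ∀ {n L w} → w ∈ stirlingWords n L → w ∈ filter stirlingWith?ˡ (insertions n L)
  stirlingWord⇒insertion {n} {L} w∈ with ∈-map⁻ toList w∈
  ... | v , v∈ , refl with ∈-filter⁻ (stirlingWith? (suc m) k) {xs = allWords (suc n) (suc m + L)} v∈
  ... | _ , q with Equivalence.to (StirlingWith⇔StirlingWithˡ (suc m) k v) q
  ... | qˡ@((occ , stir) , _) with insert-surjective m (toList v) (length-toList v) (occ fzero) stir
  ... | a , j , v≡ = ∈-filter⁺ stirlingWith?ˡ
    (subst (_∈ insertions n L) (sym v≡) (∈-cartesianProductWith⁺ (insert m) (∈-allWords a) (∈-allFin j)))
    (Equivalence.from (StirlingWith-fromList⇔ (suc m) k (toList v)) qˡ)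

  insertion⇒stirlingWord : ∀ {n L w} → w ∈ filter stirlingWith?ˡ (insertions n L) → w ∈ stirlingWords n L
  insertion⇒stirlingWord {n} {L} w∈ with ∈-filter⁻ stirlingWith?ˡ {xs = insertions n L} w∈
  ... | w∈ins , q with ∈-cartesianProductWith⁻ (insert m) (allWords n L) (allFin (suc L)) w∈ins
  ... | a , j , _ , _ , refl = subst (_∈ stirlingWords n L) toList-v
    (∈-map⁺ toList (∈-filter⁺ (stirlingWith? (suc m) k) (∈-allWords v)
      (Equivalence.from (StirlingWith⇔StirlingWithˡ (suc m) k v)
        (subst (StirlingWithˡ (suc m) k) (sym toList-v) (Equivalence.to (StirlingWith-fromList⇔ (suc m) k w) q)))))
    where
    w : List (Fin (suc n))
    w = insert m a j
    v : Vec (Fin (suc n)) (suc m + L)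
    v = cast (length-insert m a j) (fromList w)
    toList-v : toList v ≡ w
    toList-v = toList-cast-fromList w (length-insert m a j)

  countStirling≡length-insertions : ∀ n L →
    countStirling (suc m) (suc n) (suc m + L) k ≡ length (filter stirlingWith?ˡ (insertions n L))
  countStirling≡length-insertions n L = trans
    (sym (length-map toList (filter (stirlingWith? (suc m) k) (allWords (suc n) (suc m + L)))))
    (unique∧set⇒length≡ stirlingWords-unique insertions-unique stirlingWord⇒insertion insertion⇒stirlingWord)
    where
    stirlingWords-unique : Unique (stirlingWords n L)
    stirlingWords-unique = map⁺ (λ {a} {b} eq → trans (sym (cast-is-id refl a)) (toList-injective refl a b eq))
                                (filter⁺ (stirlingWith? (suc m) k) (allWords-unique (suc n) (suc m + L)))
    insertions-unique : Unique (filter stirlingWith?ˡ (insertions n L))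
    insertions-unique = filter⁺ stirlingWith?ˡ
      (cartesianProductWith⁺ (insert m) (insert-injective m) (allWords-unique n L) (allFin⁺ (suc L)))

  countStirling-insert : ∀ n L → countStirling (suc m) (suc n) (suc m + L) k ≡
    sum (map (λ a → sum (map (λ j → indicator (stirlingWith?ˡ (insert m a j))) (allFin (suc L)))) (allWords n L))
  countStirling-insert n L = begin
    countStirling (suc m) (suc n) (suc m + L) k      ≡⟨ countStirling≡length-insertions n L ⟩
    length (filter stirlingWith?ˡ (insertions n L))  ≡⟨ length-filter stirlingWith?ˡ (insertions n L) ⟩
    sum (map (indicator ∘ stirlingWith?ˡ) (insertions n L))
      ≡⟨ sum-map-cartesianProductWith (insert m) (indicator ∘ stirlingWith?ˡ) (allWords n L) (allFin (suc L)) ⟩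
    sum (map (λ a → sum (map (λ j → indicator (stirlingWith?ˡ (insert m a j))) (allFin (suc L)))) (allWords n L)) ∎

  sum-insert-positions : (a : Vec (Fin n) L) →
    sum (map (λ j → indicator (stirlingWith?ˡ (insert m a j))) (allFin (suc L))) ≡
    suc (descents a) * (indicator (isStirlingWord? (suc m) a) * indicator (descents a ≟ k)) +
    (L ∸ descents a) * (indicator (isStirlingWord? (suc m) a) * indicator (suc (descents a) ≟ k))
  sum-insert-positions a = begin
    sum (map f (allFin _))                ≡⟨ cong sum (map-tabulate (λ j → j) f) ⟩
    sum (tabulate f)                      ≡⟨ cong sum (tabulate-cong (indicator-stirlingWith-insert a)) ⟩
    sum (tabulate (g ∘ descentGain a))    ≡⟨ sum-tabulate-descentGain g a ⟩
    _                                     ∎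
    where
    f : Fin _ → ℕ
    f j = indicator (stirlingWith?ˡ (insert m a j))
    g : ℕ → ℕ
    g x = indicator (isStirlingWord? (suc m) a) * indicator (x + descents a ≟ k)

countStirling-sum : ∀ m n L k → countStirling m n L k ≡
  sum (map (λ a → indicator (isStirlingWord? m a) * indicator (descents a ≟ k)) (allWords n L))
countStirling-sum m n L k = trans (length-filter (stirlingWith? m k) (allWords n L))
  (cong sum (map-cong (λ a → indicator-×-dec (isStirlingWord? m a) (descents a ≟ k)) (allWords n L)))

countStirling-suc-zero : ∀ m n L → countStirling (suc m) (suc n) (suc m + L) 0 ≡ countStirling (suc m) n L 0
countStirling-suc-zero m n L = begin
  countStirling (suc m) (suc n) (suc m + L) 0
    ≡⟨ countStirling-insert m 0 n L ⟩
  sum (map (λ a → sum (map (λ j → indicator (stirlingWith?ˡ m 0 (insert m a j))) (allFin (suc L)))) (allWords n L))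
    ≡⟨ cong sum (map-cong (λ a → trans (sum-insert-positions m 0 a) (no-descent a)) (allWords n L)) ⟩
  sum (map (λ a → indicator (isStirlingWord? (suc m) a) * indicator (descents a ≟ 0)) (allWords n L))
    ≡⟨ countStirling-sum (suc m) n L 0 ⟨
  countStirling (suc m) n L 0 ∎
  where
  no-descent : (a : Vec (Fin n) L) → let c = indicator (isStirlingWord? (suc m) a); d = descents a in
    suc d * (c * indicator (d ≟ 0)) + (L ∸ d) * (c * indicator (suc d ≟ 0)) ≡ c * indicator (d ≟ 0)
  no-descent a = trans (cong (_+ (L ∸ d) * (c * indicator (suc d ≟ 0))) (*-indicator-≟ suc c d 0))
                       (x+y*[c*0]≡x (c * indicator (d ≟ 0)) (L ∸ d) c)
    where
    c : ℕ
    c = indicator (isStirlingWord? (suc m) a)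
    d : ℕ
    d = descents a
    x+y*[c*0]≡x : ∀ x y c → 1 * x + y * (c * 0) ≡ x
    x+y*[c*0]≡x = solve-∀

countStirling-suc-suc : ∀ m n L k → countStirling (suc m) (suc n) (suc m + L) (suc k) ≡
  suc (suc k) * countStirling (suc m) n L (suc k) + (L ∸ k) * countStirling (suc m) n L k
countStirling-suc-suc m n L k = begin
  countStirling (suc m) (suc n) (suc m + L) (suc k)
    ≡⟨ countStirling-insert m (suc k) n L ⟩
  sum (map (λ a → sum (map (λ j → indicator (stirlingWith?ˡ m (suc k) (insert m a j))) (allFin (suc L)))) (allWords n L))
    ≡⟨ cong sum (map-cong (λ a → trans (sum-insert-positions m (suc k) a) (by-descents a)) (allWords n L)) ⟩
  sum (map (λ a → suc (suc k) * counts (suc k) a + (L ∸ k) * counts k a) (allWords n L))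
    ≡⟨ sum-map-+ (λ a → suc (suc k) * counts (suc k) a) (λ a → (L ∸ k) * counts k a) (allWords n L) ⟩
  sum (map (λ a → suc (suc k) * counts (suc k) a) (allWords n L)) + sum (map (λ a → (L ∸ k) * counts k a) (allWords n L))
    ≡⟨ cong₂ _+_ (sum-map-*ˡ (suc (suc k)) (counts (suc k)) (allWords n L))
                 (sum-map-*ˡ (L ∸ k) (counts k) (allWords n L)) ⟩
  suc (suc k) * sum (map (counts (suc k)) (allWords n L)) + (L ∸ k) * sum (map (counts k) (allWords n L))
    ≡⟨ cong₂ (λ x y → suc (suc k) * x + (L ∸ k) * y)
             (countStirling-sum (suc m) n L (suc k)) (countStirling-sum (suc m) n L k) ⟨
  suc (suc k) * countStirling (suc m) n L (suc k) + (L ∸ k) * countStirling (suc m) n L k ∎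
  where
  counts : ℕ → Vec (Fin n) L → ℕ
  counts k a = indicator (isStirlingWord? (suc m) a) * indicator (descents a ≟ k)
  by-descents : (a : Vec (Fin n) L) → let c = indicator (isStirlingWord? (suc m) a); d = descents a in
    suc d * (c * indicator (d ≟ suc k)) + (L ∸ d) * (c * indicator (suc d ≟ suc k)) ≡
    suc (suc k) * counts (suc k) a + (L ∸ k) * counts k a
  by-descents a = cong₂ _+_ (*-indicator-≟ suc c d (suc k)) (begin
    (L ∸ d) * (c * indicator (suc d ≟ suc k))
      ≡⟨ cong (λ x → (L ∸ d) * (c * x)) (indicator-cong suc-injective (cong suc) (suc d ≟ suc k) (d ≟ k)) ⟩
    (L ∸ d) * (c * indicator (d ≟ k))
      ≡⟨ *-indicator-≟ (L ∸_) c d k ⟩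
    (L ∸ k) * (c * indicator (d ≟ k)) ∎)
    where
    c : ℕ
    c = indicator (isStirlingWord? (suc m) a)
    d : ℕ
    d = descents a

-- The recurrence for T and the explicit formula

T-zero-zero : ∀ m → T m 0 0 ≡ 1
T-zero-zero m = cong (λ L → countStirling m 0 L 0) (*-zeroʳ m)

T-zero-suc : ∀ m k → T m 0 (suc k) ≡ 0
T-zero-suc m k = cong (λ L → countStirling m 0 L (suc k)) (*-zeroʳ m)

T-suc-zero : ∀ m n → T (suc m) (suc n) 0 ≡ T (suc m) n 0
T-suc-zero m n = trans (cong (λ L → countStirling (suc m) (suc n) L 0) (*-suc (suc m) n))
                       (countStirling-suc-zero m n (suc m * n))

T-suc-suc : ∀ m n k → T (suc m) (suc n) (suc k) ≡ suc (suc k) * T (suc m) n (suc k) + (suc m * n ∸ k) * T (suc m) n k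
T-suc-suc m n k = trans (cong (λ L → countStirling (suc m) (suc n) L (suc k)) (*-suc (suc m) n))
                        (countStirling-suc-suc m n (suc m * n) k)

T-no-descents : ∀ m n → T (suc m) n 0 ≡ 1
T-no-descents m zero    = T-zero-zero (suc m)
T-no-descents m (suc n) = trans (T-suc-zero m n) (T-no-descents m n)

T-vanishes : ∀ m n k → n ≤ k → T (suc m) (suc n) (suc k) ≡ 0
T-vanishes m zero k _ = begin
  T (suc m) 1 (suc k)
    ≡⟨ T-suc-suc m 0 k ⟩
  suc (suc k) * T (suc m) 0 (suc k) + (suc m * 0 ∸ k) * T (suc m) 0 k
    ≡⟨ cong₂ (λ x y → suc (suc k) * x + (y ∸ k) * T (suc m) 0 k) (T-zero-suc (suc m) k) (*-zeroʳ (suc m)) ⟩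
  suc (suc k) * 0 + (0 ∸ k) * T (suc m) 0 k
    ≡⟨ cong₂ (λ x y → x + y * T (suc m) 0 k) (*-zeroʳ (suc (suc k))) (0∸n≡0 k) ⟩
  0 ∎
T-vanishes m (suc n) (suc k) (s≤s n≤k) = begin
  T (suc m) (suc (suc n)) (suc (suc k))
    ≡⟨ T-suc-suc m (suc n) (suc k) ⟩
  suc (suc (suc k)) * T (suc m) (suc n) (suc (suc k)) + (suc m * suc n ∸ suc k) * T (suc m) (suc n) (suc k)
    ≡⟨ cong₂ (λ x y → suc (suc (suc k)) * x + (suc m * suc n ∸ suc k) * y)
             (T-vanishes m n (suc k) (m≤n⇒m≤1+n n≤k)) (T-vanishes m n k n≤k) ⟩
  suc (suc (suc k)) * 0 + (suc m * suc n ∸ suc k) * 0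
    ≡⟨ cong₂ _+_ (*-zeroʳ (suc (suc (suc k)))) (*-zeroʳ (suc m * suc n ∸ suc k)) ⟩
  0 ∎

-- The coefficient mn − d of the recurrence at n = M + d + 1 is the factor of the formula
-- attached to a composition whose first d + 1 parts sum to M.
*-+-∸≡weight : ∀ m M d → suc m * (M + suc d) ∸ d ≡ weight (suc m) (suc d) M
*-+-∸≡weight m M d = trans (cong (_∸ d) (expand m M d)) (m+n∸m≡n d _)
  where
  expand : ∀ m M d → suc m * (M + suc d) ≡ d + (suc m * M + suc d * m + 1)
  expand = solve-∀

T≡sumCompositions : ∀ m d N → T (suc m) (N + suc d) d ≡ sumCompositions (suc d) N (rhsTerm (suc m) d)
T≡sumCompositions m zero N = trans (T-no-descents m (N + 1)) (sym (sumCompositions-rhsTerm-zero (suc m) N))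
T≡sumCompositions m (suc d) N = begin
  T (suc m) (N + suc (suc d)) (suc d)
    ≡⟨ unroll-linear-recurrence (suc (suc d)) u v u₀ uₛ N ⟩
  ∑[ s < suc N ] (suc (suc d) ^ s * v (N ∸ s))
    ≡⟨ ∑-cong (suc N) (λ s → cong (λ x → suc (suc d) ^ s * (weight (suc m) (suc d) (N ∸ s) * x))
                                  (T≡sumCompositions m d (N ∸ s))) ⟩
  ∑[ s < suc N ] (suc (suc d) ^ s * (weight (suc m) (suc d) (N ∸ s) * sumCompositions (suc d) (N ∸ s) (rhsTerm (suc m) d)))
    ≡⟨ sumCompositions-rhsTerm-suc (suc m) d N ⟨
  sumCompositions (suc (suc d)) N (rhsTerm (suc m) (suc d)) ∎
  where
  u : ℕ → ℕ
  u M = T (suc m) (M + suc (suc d)) (suc d)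
  v : ℕ → ℕ
  v M = weight (suc m) (suc d) M * T (suc m) (M + suc d) d
  u₀ : u 0 ≡ v 0
  u₀ = begin
    T (suc m) (suc (suc d)) (suc d)
      ≡⟨ T-suc-suc m (suc d) d ⟩
    suc (suc d) * T (suc m) (suc d) (suc d) + (suc m * suc d ∸ d) * T (suc m) (suc d) d
      ≡⟨ cong₂ (λ x y → suc (suc d) * x + y * T (suc m) (suc d) d) (T-vanishes m d d ≤-refl) (*-+-∸≡weight m 0 d) ⟩
    suc (suc d) * 0 + v 0
      ≡⟨ cong (_+ v 0) (*-zeroʳ (suc (suc d))) ⟩
    v 0 ∎
  uₛ : ∀ M → u (suc M) ≡ suc (suc d) * u M + v (suc M)
  uₛ M = begin
    T (suc m) (suc (M + suc (suc d))) (suc d)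
      ≡⟨ T-suc-suc m (M + suc (suc d)) d ⟩
    suc (suc d) * u M + (suc m * (M + suc (suc d)) ∸ d) * T (suc m) (M + suc (suc d)) d
      ≡⟨ cong (λ n → suc (suc d) * u M + (suc m * n ∸ d) * T (suc m) n d) (+-suc M (suc d)) ⟩
    suc (suc d) * u M + (suc m * (suc M + suc d) ∸ d) * T (suc m) (suc M + suc d) d
      ≡⟨ cong (λ x → suc (suc d) * u M + x * T (suc m) (suc M + suc d) d) (*-+-∸≡weight m (suc M) d) ⟩
    suc (suc d) * u M + v (suc M) ∎

theorem4p1 : (m n k : ℕ) → 1 ≤ m → 1 ≤ n → k < n → T m n k ≡ RHS m n k
theorem4p1 (suc m) n k _ _ k<n = begin
  T (suc m) n k                                        ≡⟨ cong (λ n → T (suc m) n k) n∸k∸1+suc[k]≡n ⟨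
  T (suc m) (N + suc k) k                              ≡⟨ T≡sumCompositions m k N ⟩
  sumCompositions (suc k) N (rhsTerm (suc m) k)        ≡⟨ sum-map-compositions (suc k) N (rhsTerm (suc m) k) ⟨
  RHS (suc m) n k                                      ∎
  where
  N : ℕ
  N = n ∸ k ∸ 1
  n∸k∸1+suc[k]≡n : N + suc k ≡ n
  n∸k∸1+suc[k]≡n = trans (cong (_+ suc k) (trans (∸-+-assoc n k 1) (cong (n ∸_) (+-comm k 1)))) (m∸n+n≡m k<n)
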